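{- Let $F=(f_1,\dots,f_m)\colon\mathbb Z_p^{n}\to\mathbb Z_p^{m}$ be uniformly differentiable modulo $p$ on $\mathbb Z_p^n$ with integer-valued partial derivatives modulo $p$. Suppose that for some integer $k\ge N_1(F)$ the function $F$ is equiprobable modulo $p^k$ and that for every $\mathbf u\in\{0,1,\dots,p^k-1\}^n$ the Jacobi matrix $F'_1(\mathbf u)$, reduced modulo $p$, has rank exactly $m$ over the field $\mathbb Z/p$. Then $F$ is asymptotically equiprobable.
   Context: $\mathbb Z_p$, $\mathbb Q_p$, $\|\cdot\|_p$ are the $p$-adic integers, numbers and norm; for vectors $\|(u_1,\dots,u_n)\|_p=\max_i\|u_i\|_p$, and $\mathbf a\equiv\mathbf b\pmod{p^s}$ means $\|\mathbf a-\mathbf b\|_p\le p^{ -s}$. $F\colon\mathbb Z_p^n\to\mathbb Z_p^m$ is uniformly differentiable modulo $p^k$ on $\mathbb Z_p^n$ if there exist $N\in\mathbb N$ and for every $\mathbf u\in\mathbb Z_p^n$ an $n\times m$ matrix $F'_k(\mathbf u)$ over $\mathbb Q_p$ (the Jacobi matrix modulo $p^k$; its entries are the partial derivatives modulo $p^k$) such that for every integer $K\ge N$, every $\mathbf u$ and every row vector $\mathbf h\in\mathbb Z_p^n$ with $\|\mathbf h\|_p\le p^{ -K}$: $F(\mathbf u+\mathbf h)\equiv F(\mathbf u)+\mathbf hF'_k(\mathbf u)\pmod{p^{k+K}}$. The least such $N$ is denoted $N_k(F)$. $F$ has integer-valued partial derivatives modulo $p^k$ if $F'_k(\mathbf u)$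 can be chosen with entries in $\mathbb Z_p$ for every $\mathbf u$. $F\bmod p^k$ is the map $\{0,\dots,p^k-1\}^n\to(\mathbb Z/p^k)^m$, $\mathbf x\mapsto F(\mathbf x)\bmod p^k$ (componentwise); $F$ is equiprobable modulo $p^k$ if every point of $(\mathbb Z/p^k)^m$ has the same number of preimages under $F\bmod p^k$, and asymptotically equiprobable if it is equiprobable modulo $p^k$ for all sufficiently large $k$. -}

module Defs where

open import Data.Nat using (ℕ; zero; suc; _+_; _*_; _^_; _≤_; _<_; NonZero)
open import Data.Nat.Properties using (m^n≢0; _≟_)
open import Data.Nat.DivMod using (_%_; m%n<n; m%n%n≡m%n; %-distribˡ-+; %-distribˡ-*; m∣n⇒o%n%m≡o%m)
open import Data.Nat.Divisibility using (_∣_; divides)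
open import Data.Fin using (Fin)
open import Data.Fin.Properties using (all?)
open import Data.List using (List; []; _∷_; length; filter; concatMap; upTo)
open import Data.Product using (Σ; ∃; _×_; _,_)
open import Relation.Binary.PropositionalEquality using (_≡_; refl; cong; cong₂; trans; sym)

-- p-adic integers as the inverse limit  lim ℤ/p^k :
-- a p-adic integer is a coherent sequence of residues  res k ∈ {0,…,p^k-1}.

module _ (p : ℕ) .{{_ : NonZero p}} where

  modP : ℕ → ℕ → ℕ
  modP k x = _%_ x (p ^ k) {{m^n≢0 p k}}

  modP-< : ∀ k x → modP k x < p ^ k
  modP-< k x = m%n<n x (p ^ k) {{m^n≢0 p k}}

  modP-coh : ∀ k x → modP k (modP (suc k) x) ≡ modP k x
  modP-coh k x = m∣n⇒o%n%m≡o%m (p ^ k) (p ^ suc k) x {{m^n≢0 p k}} {{m^n≢0 p (suc k)}}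
                   (divides p refl)

record ℤₚ (p : ℕ) .{{nz : NonZero p}} : Set where
  constructor mkℤₚ
  field
    res   : ℕ → ℕ
    res-< : ∀ k → res k < p ^ k
    coh   : ∀ k → modP p k (res (suc k)) ≡ res k
open ℤₚ public

module _ {p : ℕ} .{{_ : NonZero p}} where

  fromℕ : ℕ → ℤₚ p
  fromℕ x = mkℤₚ (λ k → modP p k x) (λ k → modP-< p k x) (λ k → modP-coh p k x)

  private
    lift-op : (_∙_ : ℕ → ℕ → ℕ)
              → (∀ a b d .{{_ : NonZero d}} → (a ∙ b) % d ≡ ((a % d) ∙ (b % d)) % d)
              → ℤₚ p → ℤₚ p → ℤₚ p
    lift-op _∙_ distr x y =
      mkℤₚ (λ k → modP p k (res x k ∙ res y k))
           (λ k → modP-< p k _)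
           (λ k → trans (modP-coh p k (res x (suc k) ∙ res y (suc k)))
                  (trans (distr (res x (suc k)) (res y (suc k)) (p ^ k) {{m^n≢0 p k}})
                  (trans (cong₂ (λ a b → modP p k (a ∙ b)) (coh x k) (coh y k)) refl)))

  _+ₚ_ : ℤₚ p → ℤₚ p → ℤₚ p
  _+ₚ_ = lift-op _+_ %-distribˡ-+

  _*ₚ_ : ℤₚ p → ℤₚ p → ℤₚ p
  _*ₚ_ = lift-op _*_ %-distribˡ-*

  0ₚ : ℤₚ p
  0ₚ = fromℕ 0

  _≈ₚ_ : ℤₚ p → ℤₚ p → Set
  x ≈ₚ y = ∀ k → res x k ≡ res y k

  -- x ≡ y (mod p^s)   i.e.  ‖x - y‖_p ≤ p^{-s}
  _≡_[modp^_] : ℤₚ p → ℤₚ p → ℕ → Set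
  x ≡ y [modp^ s ] = res x s ≡ res y s

module _ {p : ℕ} .{{_ : NonZero p}} where

  Vecₚ : ℕ → Set
  Vecₚ n = Fin n → ℤₚ p

  _≡ᵥ_[modp^_] : ∀ {n} → Vecₚ n → Vecₚ n → ℕ → Set
  a ≡ᵥ b [modp^ s ] = ∀ i → a i ≡ b i [modp^ s ]

  _+ᵥ_ : ∀ {n} → Vecₚ n → Vecₚ n → Vecₚ n
  (a +ᵥ b) i = a i +ₚ b i

  sumₚ : ∀ n → (Fin n → ℤₚ p) → ℤₚ p
  sumₚ zero    f = 0ₚ
  sumₚ (suc n) f = f Fin.zero +ₚ sumₚ n (λ i → f (Fin.suc i))

  _·ₘ_ : ∀ {n m} → Vecₚ n → (Fin n → Fin m → ℤₚ p) → Vecₚ m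
  _·ₘ_ {n} h A j = sumₚ n (λ i → h i *ₚ A i j)

  RespectsEq : ∀ {n m} → (Vecₚ n → Vecₚ m) → Set
  RespectsEq {n} F = ∀ (u v : Vecₚ n) → (∀ i → u i ≈ₚ v i) → ∀ j → F u j ≈ₚ F v j

  UnifDiffWith : ∀ {n m} → ℕ → (Vecₚ n → Vecₚ m) → ℕ
                 → (Vecₚ n → Fin n → Fin m → ℤₚ p) → Set
  UnifDiffWith {n} k F N D =
    ∀ (K : ℕ) → N ≤ K → ∀ (u h : Vecₚ n) → h ≡ᵥ (λ _ → 0ₚ) [modp^ K ] →
      F (u +ᵥ h) ≡ᵥ (F u +ᵥ (h ·ₘ D u)) [modp^ (k + K) ]

  IsLeastN : ∀ {n m} → ℕ → (Vecₚ n → Vecₚ m) → ℕ → Set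
  IsLeastN {n} {m} k F N =
    ∀ N' (D' : Vecₚ n → Fin n → Fin m → ℤₚ p) → UnifDiffWith k F N' D' → N ≤ N'

-- Rank over ℤ/p.  rank = m for an n×m matrix A means its m columns are
-- linearly independent over 𝔽_p (column rank = m).

module _ (p : ℕ) .{{_ : NonZero p}} where

  sumℕ : ∀ m → (Fin m → ℕ) → ℕ
  sumℕ zero    f = 0
  sumℕ (suc m) f = f Fin.zero + sumℕ m (λ j → f (Fin.suc j))

  RankModpIsM : ∀ {n m} → (Fin n → Fin m → ℤₚ p) → Set
  RankModpIsM {n} {m} A =
    ∀ (c : Fin m → Fin p) →
      (∀ i → modP p 1 (sumℕ m (λ j → res (A i j) 1 * Data.Fin.toℕ (c j))) ≡ 0) →
      ∀ j → Data.Fin.toℕ (c j) ≡ 0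

allVecs : (q n : ℕ) → List (Fin n → ℕ)
allVecs q zero    = (λ ()) ∷ []
allVecs q (suc n) = concatMap (λ x → Data.List.map (λ v → cons x v) (allVecs q n)) (upTo q)
  where
    cons : ℕ → (Fin n → ℕ) → Fin (suc n) → ℕ
    cons x v Fin.zero    = x
    cons x v (Fin.suc i) = v i

module _ {p : ℕ} .{{_ : NonZero p}} {n m : ℕ} (F : Vecₚ {p} n → Vecₚ {p} m) where

  Fmod : ℕ → (Fin n → ℕ) → Fin m → ℕ
  Fmod k x j = res (F (λ i → fromℕ (x i)) j) k

  preimageCount : ℕ → (Fin m → ℕ) → ℕ
  preimageCount k y =
    length (filter (λ x → all? (λ j → Fmod k x j ≟ y j)) (allVecs (p ^ k) n))

  EquiprobableMod : ℕ → Set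
  EquiprobableMod k =
    ∀ (y y' : Fin m → ℕ) → (∀ j → y j < p ^ k) → (∀ j → y' j < p ^ k) →
      preimageCount k y ≡ preimageCount k y'

  AsymptoticallyEquiprobable : Set
  AsymptoticallyEquiprobable = ∃ λ K → ∀ k → K ≤ k → EquiprobableMod k

-- Hensel-type lifting. For s ≥ k ≥ N write a point of {0, …, p^(s+1) - 1}^n as x = x₀ + p^s t with
-- x₀ < p^s and t ∈ {0, …, p - 1}^n. Uniform differentiability gives F(x) ≡ F(x₀) + p^s t·F'₁(x₀) (mod p^(s+1)),
-- so F(x) ≡ y (mod p^(s+1)) iff F(x₀) ≡ y (mod p^s) and t solves an affine system mod p whose matrix is the
-- Jacobian F'₁(x₀) mod p. The Jacobian mod p depends only on x₀ mod p^N, so the rank hypothesis on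
-- {0, …, p^k - 1}^n makes its columns independent everywhere, and then the system has exactly p^(n-m)
-- solutions (Gaussian elimination). Hence every y has p^(n-m) times as many preimages mod p^(s+1) as y mod p^s
-- has mod p^s, and equiprobability passes from p^s to p^(s+1).

module Submission where

open import Defs
open import Data.Nat using (ℕ; zero; suc; _+_; _*_; _^_; _∸_; _≤_; _<_; _≤′_; ≤′-reflexive; ≤′-step; z≤n; s≤s; NonZero; ≢-nonZero; nonTrivial⇒n>1; _%_; _/_)
open import Data.Nat.Properties using (+-*-semiring; _≟_; +-assoc; +-comm; +-identityʳ; +-cancelʳ-≡; *-comm; *-assoc; *-identityˡ; *-identityʳ; *-zeroʳ; *-distribʳ-+; *-cancelʳ-≡; suc-injective; m^n≢0; ^-distribˡ-+-*; m∸n+n≡m; ≤-refl; ≤-trans; <-trans; <⇒≤; ≤⇒≤′; ≤′⇒≤)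
open import Data.Nat.DivMod using (m%n<n; m%n≤n; m%n%n≡m%n; %-congʳ; %-distribˡ-+; %-distribˡ-*; m*n%n≡0; n%n≡0; m≡m%n+[m/n]*n; [m+kn]%n≡m%n; m<n⇒m%n≡m; m<n*o⇒m/o<n; m∣n⇒o%n%m≡o%m; m%n*o≡m*o%[n*o]; [m*n+o]%[p*n]≡[m*n]%[p*n]+o)
open import Data.Nat.Divisibility using (_∣_; divides; ∣-trans; n∣m*n; m∣m*n; n∣m⇒m%n≡0)
open import Data.Nat.Primality using (Prime; prime⇒nonTrivial)
open import Data.Nat.Coprimality using (prime⇒coprime; coprime-Bézout)
open import Data.Nat.GCD using (module Bézout)
open import Data.Nat.ListAction using () renaming (sum to sumList)
open import Data.Nat.ListAction.Properties using () renaming (sum-++ to sumList-++)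
open import Data.Nat.Tactic.RingSolver using (solve-∀)
open import Data.Fin as Fin using (Fin; zero; suc; toℕ; fromℕ<; punchIn)
open import Data.Fin.Properties using (all?; any?; toℕ-fromℕ<; punchIn-punchOut; punchInᵢ≢i)
open import Data.Vec.Functional using (Vector; []; _∷_; insertAt)
open import Data.Vec.Functional.Properties using (∷-cong; insertAt-lookup; insertAt-punchIn)
open import Data.List as List using (List; _++_; length; filter; concatMap; map; upTo; applyUpTo)
open import Data.List.Properties using (map-++; map-∘)
open import Data.Product using (∃; _×_; _,_; proj₁; proj₂; swap)
open import Data.Product.Function.NonDependent.Propositional using (_×-⇔_)
open import Data.Unit using (tt)
open import Function using (_∘_; _⇔_; mk⇔; Equivalence)
open import Function.Construct.Composition using (_⇔-∘_)
open import Level using (0ℓ)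
open import Relation.Nullary using (¬_; Dec; yes; no; ¬?; contradiction)
open import Relation.Nullary.Decidable using (decidable-stable)
open import Relation.Unary using (Decidable)
open import Relation.Binary using (Setoid; IsEquivalence)
open import Relation.Binary.PropositionalEquality
import Relation.Binary.Reasoning.Setoid as SetoidReasoning
open import Algebra.Properties.Semiring.Sum +-*-semiring using (sum; sum-syntax; sum-cong-≗; sum-remove; sum-replicate-zero; ∑-comm; ∑-distrib-+; *-distribˡ-sum; *-distribʳ-sum)

-- Finite sums over ranges and boxes

sumBelow : ℕ → (ℕ → ℕ) → ℕ
sumBelow q f = sum {q} (f ∘ toℕ)

sumBelow-cong : ∀ q {f g : ℕ → ℕ} → (∀ x → x < q → f x ≡ g x) → sumBelow q f ≡ sumBelow q g
sumBelow-cong zero    f≗g = refl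
sumBelow-cong (suc q) f≗g = cong₂ _+_ (f≗g 0 (s≤s z≤n)) (sumBelow-cong q (λ x x<q → f≗g (suc x) (s≤s x<q)))

sumBelow-*ʳ : ∀ q (f : ℕ → ℕ) c → sumBelow q (λ x → f x * c) ≡ sumBelow q f * c
sumBelow-*ʳ q f c = sym (*-distribʳ-sum c (f ∘ toℕ {q}))

sumBelow-const : ∀ q c → sumBelow q (λ _ → c) ≡ q * c
sumBelow-const zero    c = refl
sumBelow-const (suc q) c = cong (c +_) (sumBelow-const q c)

sumBelow-comm : ∀ a b (f : ℕ → ℕ → ℕ) →
  sumBelow a (λ x → sumBelow b (f x)) ≡ sumBelow b (λ y → sumBelow a (λ x → f x y))
sumBelow-comm a b f = ∑-comm {a} {b} (λ x y → f (toℕ x) (toℕ y))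

sumBelow-+ : ∀ a b (f : ℕ → ℕ) → sumBelow (a + b) f ≡ sumBelow a f + sumBelow b (λ x → f (a + x))
sumBelow-+ zero    b f = refl
sumBelow-+ (suc a) b f = trans (cong (f 0 +_) (sumBelow-+ a b (f ∘ suc))) (sym (+-assoc (f 0) _ _))

sumBelow-* : ∀ b a (f : ℕ → ℕ) → sumBelow (b * a) f ≡ sumBelow b (λ t → sumBelow a (λ x → f (t * a + x)))
sumBelow-* zero    a f = refl
sumBelow-* (suc b) a f = begin
  sumBelow (a + b * a) f                                             ≡⟨ sumBelow-+ a (b * a) f ⟩
  sumBelow a f + sumBelow (b * a) (λ x → f (a + x))                  ≡⟨ cong (sumBelow a f +_) (sumBelow-* b a (λ x → f (a + x))) ⟩
  sumBelow a f + sumBelow b (λ t → sumBelow a (λ x → f (a + (t * a + x))))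
    ≡⟨ cong (sumBelow a f +_) (sumBelow-cong b (λ t _ → sumBelow-cong a (λ x _ → cong f (sym (+-assoc a (t * a) x))))) ⟩
  sumBelow a f + sumBelow b (λ t → sumBelow a (λ x → f (a + t * a + x))) ∎
  where open ≡-Reasoning

sumBelow-single : ∀ q (f : ℕ → ℕ) {x₀} → x₀ < q → (∀ x → x < q → x ≢ x₀ → f x ≡ 0) → sumBelow q f ≡ f x₀
sumBelow-single (suc q) f {zero} _ f≡0 = begin
  f 0 + sumBelow q (f ∘ suc)                  ≡⟨ cong (f 0 +_) (sumBelow-cong q (λ x x<q → f≡0 (suc x) (s≤s x<q) λ ())) ⟩
  f 0 + sumBelow q (λ _ → 0)                  ≡⟨ cong (f 0 +_) (trans (sumBelow-const q 0) (*-zeroʳ q)) ⟩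
  f 0 + 0                                     ≡⟨ +-identityʳ (f 0) ⟩
  f 0 ∎
  where open ≡-Reasoning
sumBelow-single (suc q) f {suc x₀} (s≤s x₀<q) f≡0 =
  cong₂ _+_ (f≡0 0 (s≤s z≤n) λ ())
            (sumBelow-single q (f ∘ suc) x₀<q (λ x x<q x≢x₀ → f≡0 (suc x) (s≤s x<q) (x≢x₀ ∘ suc-injective)))

Respects≗ : ∀ {n} → (Vector ℕ n → ℕ) → Set
Respects≗ f = ∀ u v → u ≗ v → f u ≡ f v

sumBox : ℕ → ∀ n → (Vector ℕ n → ℕ) → ℕ
sumBox q zero    f = f []
sumBox q (suc n) f = sumBelow q (λ x → sumBox q n (f ∘ (x ∷_)))

sumBox-cong : ∀ q n {f g : Vector ℕ n → ℕ} → (∀ v → (∀ i → v i < q) → f v ≡ g v) → sumBox q n f ≡ sumBox q n g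
sumBox-cong q zero    f≗g = f≗g [] λ ()
sumBox-cong q (suc n) f≗g = sumBelow-cong q λ x x<q → sumBox-cong q n λ v v<q →
  f≗g (x ∷ v) λ { zero → x<q ; (suc i) → v<q i }

sumBox-*ʳ : ∀ q n (f : Vector ℕ n → ℕ) c → sumBox q n (λ v → f v * c) ≡ sumBox q n f * c
sumBox-*ʳ q zero    f c = refl
sumBox-*ʳ q (suc n) f c =
  trans (sumBelow-cong q λ x _ → sumBox-*ʳ q n (f ∘ (x ∷_)) c) (sumBelow-*ʳ q (λ x → sumBox q n (f ∘ (x ∷_))) c)

sumBox-const : ∀ q n c → sumBox q n (λ _ → c) ≡ q ^ n * c
sumBox-const q zero    c = sym (+-identityʳ c)
sumBox-const q (suc n) c = begin
  sumBelow q (λ _ → sumBox q n (λ _ → c))  ≡⟨ sumBelow-cong q (λ _ _ → sumBox-const q n c) ⟩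
  sumBelow q (λ _ → q ^ n * c)             ≡⟨ sumBelow-const q _ ⟩
  q * (q ^ n * c)                          ≡⟨ sym (*-assoc q (q ^ n) c) ⟩
  q ^ suc n * c ∎
  where open ≡-Reasoning

sumBelow-sumBox-comm : ∀ a b n (f : ℕ → Vector ℕ n → ℕ) →
  sumBelow a (λ x → sumBox b n (f x)) ≡ sumBox b n (λ v → sumBelow a (λ x → f x v))
sumBelow-sumBox-comm a b zero    f = refl
sumBelow-sumBox-comm a b (suc n) f =
  trans (sumBelow-comm a b (λ x y → sumBox b n (f x ∘ (y ∷_))))
        (sumBelow-cong b λ y _ → sumBelow-sumBox-comm a b n (λ x v → f x (y ∷ v)))

sumBox-* : ∀ b a n (f : Vector ℕ n → ℕ) → Respects≗ f →
  sumBox (b * a) n f ≡ sumBox a n (λ x₀ → sumBox b n (λ t → f (λ i → t i * a + x₀ i)))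
sumBox-* b a zero    f f-resp = f-resp _ _ λ ()
sumBox-* b a (suc n) f f-resp = begin
  sumBelow (b * a) (λ x → sumBox (b * a) n (f ∘ (x ∷_)))
    ≡⟨ sumBelow-cong (b * a) (λ x _ → sumBox-* b a n (f ∘ (x ∷_)) λ u v u≗v → f-resp (x ∷ u) (x ∷ v) (∷-cong refl u≗v)) ⟩
  sumBelow (b * a) (λ x → sumBox a n (λ x₀ → sumBox b n (g x x₀)))
    ≡⟨ sumBelow-* b a (λ x → sumBox a n (λ x₀ → sumBox b n (g x x₀))) ⟩
  sumBelow b (λ t₀ → sumBelow a (λ x → sumBox a n (λ x₀ → sumBox b n (g (t₀ * a + x) x₀))))
    ≡⟨ sumBelow-comm b a (λ t₀ x → sumBox a n (λ x₀ → sumBox b n (g (t₀ * a + x) x₀))) ⟩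
  sumBelow a (λ x → sumBelow b (λ t₀ → sumBox a n (λ x₀ → sumBox b n (g (t₀ * a + x) x₀))))
    ≡⟨ sumBelow-cong a (λ x _ → sumBelow-sumBox-comm b a n (λ t₀ x₀ → sumBox b n (g (t₀ * a + x) x₀))) ⟩
  sumBelow a (λ x → sumBox a n (λ x₀ → sumBelow b (λ t₀ → sumBox b n (g (t₀ * a + x) x₀))))
    ≡⟨ sumBelow-cong a (λ x _ → sumBox-cong a n λ x₀ _ → sumBelow-cong b λ t₀ _ → sumBox-cong b n λ t _ →
         f-resp ((t₀ * a + x) ∷ (λ i → t i * a + x₀ i)) (λ i → (t₀ ∷ t) i * a + (x ∷ x₀) i) λ { zero → refl ; (suc i) → refl }) ⟩
  sumBelow a (λ x → sumBox a n (λ x₀ → sumBelow b (λ t₀ → sumBox b n (λ t → f (λ i → (t₀ ∷ t) i * a + (x ∷ x₀) i))))) ∎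
  where
  open ≡-Reasoning
  g : ℕ → Vector ℕ n → Vector ℕ n → ℕ
  g x x₀ t = f (x ∷ (λ i → t i * a + x₀ i))

sumBox-insertAt : ∀ q n (i₀ : Fin (suc n)) (f : Vector ℕ (suc n) → ℕ) → Respects≗ f →
  sumBox q (suc n) f ≡ sumBelow q (λ x → sumBox q n (λ t → f (insertAt t i₀ x)))
sumBox-insertAt q n zero f f-resp =
  sumBelow-cong q λ x _ → sumBox-cong q n λ t _ → f-resp (x ∷ t) (insertAt t zero x) λ { zero → refl ; (suc i) → refl }
sumBox-insertAt q (suc n) (suc i₀) f f-resp = begin
  sumBelow q (λ y → sumBox q (suc n) (f ∘ (y ∷_)))
    ≡⟨ sumBelow-cong q (λ y _ → sumBox-insertAt q n i₀ (f ∘ (y ∷_)) λ u v u≗v → f-resp (y ∷ u) (y ∷ v) (∷-cong refl u≗v)) ⟩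
  sumBelow q (λ y → sumBelow q (λ x → sumBox q n (λ t → f (y ∷ insertAt t i₀ x))))
    ≡⟨ sumBelow-comm q q (λ y x → sumBox q n (λ t → f (y ∷ insertAt t i₀ x))) ⟩
  sumBelow q (λ x → sumBelow q (λ y → sumBox q n (λ t → f (y ∷ insertAt t i₀ x))))
    ≡⟨ sumBelow-cong q (λ x _ → sumBelow-cong q λ y _ → sumBox-cong q n λ t _ →
         f-resp (y ∷ insertAt t i₀ x) (insertAt (y ∷ t) (suc i₀) x) λ { zero → refl ; (suc i) → refl }) ⟩
  sumBelow q (λ x → sumBelow q (λ y → sumBox q n (λ t → f (insertAt (y ∷ t) (suc i₀) x)))) ∎
  where open ≡-Reasoning

𝟙 : ∀ {a} {P : Set a} → Dec P → ℕ
𝟙 (yes _) = 1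
𝟙 (no _)  = 0

𝟙-cong : ∀ {a b} {P : Set a} {Q : Set b} (P? : Dec P) (Q? : Dec Q) → (P → Q) → (Q → P) → 𝟙 P? ≡ 𝟙 Q?
𝟙-cong (yes _) (yes _) _   _   = refl
𝟙-cong (yes p) (no ¬q) P→Q _   = contradiction (P→Q p) ¬q
𝟙-cong (no ¬p) (yes q) _   Q→P = contradiction (Q→P q) ¬p
𝟙-cong (no _)  (no _)  _   _   = refl

length-filter : ∀ {A : Set} {P : A → Set} (P? : Decidable P) xs → length (filter P? xs) ≡ sumList (map (𝟙 ∘ P?) xs)
length-filter P? List.[]       = refl
length-filter P? (x List.∷ xs) with P? x
... | yes _ = cong suc (length-filter P? xs)
... | no _  = length-filter P? xs

sumList-concatMap : ∀ {A B : Set} (f : B → ℕ) (g : A → List B) xs →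
  sumList (map f (concatMap g xs)) ≡ sumList (map (λ x → sumList (map f (g x))) xs)
sumList-concatMap f g List.[]       = refl
sumList-concatMap f g (x List.∷ xs) = begin
  sumList (map f (g x ++ concatMap g xs))                   ≡⟨ cong sumList (map-++ f (g x) _) ⟩
  sumList (map f (g x) ++ map f (concatMap g xs))           ≡⟨ sumList-++ (map f (g x)) _ ⟩
  sumList (map f (g x)) + sumList (map f (concatMap g xs))  ≡⟨ cong (sumList (map f (g x)) +_) (sumList-concatMap f g xs) ⟩
  sumList (map f (g x)) + sumList (map (λ x → sumList (map f (g x))) xs) ∎
  where open ≡-Reasoning

sumList-applyUpTo : ∀ (f g : ℕ → ℕ) q → sumList (map f (applyUpTo g q)) ≡ sumBelow q (f ∘ g)
sumList-applyUpTo f g zero    = refl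
sumList-applyUpTo f g (suc q) = cong (f (g 0) +_) (sumList-applyUpTo f (g ∘ suc) q)

sumList-allVecs : ∀ q n (f : Vector ℕ n → ℕ) → Respects≗ f → sumList (map f (allVecs q n)) ≡ sumBox q n f
sumList-allVecs q zero    f f-resp = trans (+-identityʳ _) (f-resp _ _ λ ())
sumList-allVecs q (suc n) f f-resp = sumList-consAll _ (λ _ _ → refl) (λ _ _ _ → refl)
  where
  -- allVecs prepends coordinates with a local function of Defs, known here only through its two equations.
  sumList-consAll : (cons : ℕ → Vector ℕ n → Vector ℕ (suc n)) →
    (∀ x v → cons x v zero ≡ x) → (∀ x v i → cons x v (suc i) ≡ v i) →
    sumList (map f (concatMap (λ x → map (cons x) (allVecs q n)) (upTo q))) ≡ sumBox q (suc n) f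
  sumList-consAll cons cons-zero cons-suc = begin
    sumList (map f (concatMap (λ x → map (cons x) (allVecs q n)) (upTo q)))
      ≡⟨ sumList-concatMap f _ (upTo q) ⟩
    sumList (map (λ x → sumList (map f (map (cons x) (allVecs q n)))) (upTo q))
      ≡⟨ sumList-applyUpTo _ (λ x → x) q ⟩
    sumBelow q (λ x → sumList (map f (map (cons x) (allVecs q n))))
      ≡⟨ sumBelow-cong q (λ x _ → cong sumList (sym (map-∘ {g = f} {f = cons x} (allVecs q n)))) ⟩
    sumBelow q (λ x → sumList (map (f ∘ cons x) (allVecs q n)))
      ≡⟨ sumBelow-cong q (λ x _ → sumList-allVecs q n (f ∘ cons x) λ u v u≗v → f-resp (cons x u) (cons x v) (cons-cong u≗v)) ⟩
    sumBelow q (λ x → sumBox q n (f ∘ cons x))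
      ≡⟨ sumBelow-cong q (λ x _ → sumBox-cong q n λ v _ → f-resp (cons x v) (x ∷ v) λ { zero → cons-zero x v ; (suc i) → cons-suc x v i }) ⟩
    sumBox q (suc n) f ∎
    where
    open ≡-Reasoning
    cons-cong : ∀ {x} {u v : Vector ℕ n} → u ≗ v → cons x u ≗ cons x v
    cons-cong {x} {u} {v} u≗v zero    = trans (cons-zero x u) (sym (cons-zero x v))
    cons-cong {x} {u} {v} u≗v (suc i) = trans (cons-suc x u i) (trans (u≗v i) (sym (cons-suc x v i)))

∑-𝟙-≟ : ∀ {n} (i : Fin n) (f : Vector ℕ n) → ∑[ i' < n ] (𝟙 (i' Fin.≟ i) * f i') ≡ f i
∑-𝟙-≟ {suc n} i f = begin
  ∑[ i' < suc n ] (𝟙 (i' Fin.≟ i) * f i')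
    ≡⟨ sum-remove {i = i} (λ i' → 𝟙 (i' Fin.≟ i) * f i') ⟩
  𝟙 (i Fin.≟ i) * f i + ∑[ i' < n ] (𝟙 (punchIn i i' Fin.≟ i) * f (punchIn i i'))
    ≡⟨ cong₂ _+_ (cong (_* f i) (𝟙-cong (i Fin.≟ i) (yes tt) _ λ _ → refl))
                 (trans (sum-cong-≗ λ i' → cong (_* f (punchIn i i')) (𝟙-cong (punchIn i i' Fin.≟ i) (no λ ()) (punchInᵢ≢i i i') λ ()))
                        (sum-replicate-zero n)) ⟩
  1 * f i + 0
    ≡⟨ trans (+-identityʳ _) (*-identityˡ (f i)) ⟩
  f i ∎
  where open ≡-Reasoning

-- Congruences

infix 4 _≈_[mod_]
-- Opaque, so that unification can read off both sides instead of meeting unfolded mod-helper terms.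
opaque
  _≈_[mod_] : ℕ → ℕ → (M : ℕ) .{{_ : NonZero M}} → Set
  a ≈ b [mod M ] = a % M ≡ b % M

module Congruence (M : ℕ) .{{_ : NonZero M}} where

  infix 4 _≈_ _≈?_
  _≈_ : ℕ → ℕ → Set
  a ≈ b = a ≈ b [mod M ]

  opaque
    unfolding _≈_[mod_]

    ≈-isEquivalence : IsEquivalence _≈_
    ≈-isEquivalence = record { refl = refl ; sym = sym ; trans = trans }

    %≡%⇒≈ : ∀ {a b} → a % M ≡ b % M → a ≈ b
    %≡%⇒≈ a%M≡b%M = a%M≡b%M

    ≈⇒%≡% : ∀ {a b} → a ≈ b → a % M ≡ b % M
    ≈⇒%≡% a≈b = a≈b

    _≈?_ : ∀ a b → Dec (a ≈ b)
    a ≈? b = a % M ≟ b % M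

  ≈-setoid : Setoid 0ℓ 0ℓ
  ≈-setoid = record { isEquivalence = ≈-isEquivalence }

  open Setoid ≈-setoid public using () renaming (refl to ≈-refl; sym to ≈-sym; trans to ≈-trans; reflexive to ≈-reflexive)
  module ≈-Reasoning = SetoidReasoning ≈-setoid

  0%M≡0 : 0 % M ≡ 0
  0%M≡0 = m*n%n≡0 0 M

  %-≈ : ∀ a → a % M ≈ a
  %-≈ a = %≡%⇒≈ (m%n%n≡m%n a M)

  *M≈0 : ∀ k → k * M ≈ 0
  *M≈0 k = %≡%⇒≈ (trans (m*n%n≡0 k M) (sym 0%M≡0))

  M≈0 : M ≈ 0
  M≈0 = %≡%⇒≈ (trans (n%n≡0 M) (sym 0%M≡0))

  ≈0⇒%≡0 : ∀ {a} → a ≈ 0 → a % M ≡ 0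
  ≈0⇒%≡0 a≈0 = trans (≈⇒%≡% a≈0) 0%M≡0

  %≡0⇒≈0 : ∀ {a} → a % M ≡ 0 → a ≈ 0
  %≡0⇒≈0 a%M≡0 = %≡%⇒≈ (trans a%M≡0 (sym 0%M≡0))

  +-cong : ∀ {a a' b b'} → a ≈ a' → b ≈ b' → a + b ≈ a' + b'
  +-cong {a} {a'} {b} {b'} a≈a' b≈b' = %≡%⇒≈ (begin
    (a + b) % M               ≡⟨ %-distribˡ-+ a b M ⟩
    (a % M + b % M) % M       ≡⟨ cong₂ (λ x y → (x + y) % M) (≈⇒%≡% a≈a') (≈⇒%≡% b≈b') ⟩
    (a' % M + b' % M) % M     ≡⟨ %-distribˡ-+ a' b' M ⟨
    (a' + b') % M ∎)
    where open ≡-Reasoning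

  *-cong : ∀ {a a' b b'} → a ≈ a' → b ≈ b' → a * b ≈ a' * b'
  *-cong {a} {a'} {b} {b'} a≈a' b≈b' = %≡%⇒≈ (begin
    (a * b) % M               ≡⟨ %-distribˡ-* a b M ⟩
    (a % M * (b % M)) % M     ≡⟨ cong₂ (λ x y → (x * y) % M) (≈⇒%≡% a≈a') (≈⇒%≡% b≈b') ⟩
    (a' % M * (b' % M)) % M   ≡⟨ %-distribˡ-* a' b' M ⟨
    (a' * b') % M ∎)
    where open ≡-Reasoning

  +-congˡ : ∀ a {b b'} → b ≈ b' → a + b ≈ a + b'
  +-congˡ a = +-cong (≈-refl {a})

  +-congʳ : ∀ b {a a'} → a ≈ a' → a + b ≈ a' + b
  +-congʳ b a≈a' = +-cong a≈a' (≈-refl {b})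

  *-congˡ : ∀ a {b b'} → b ≈ b' → a * b ≈ a * b'
  *-congˡ a = *-cong (≈-refl {a})

  *-congʳ : ∀ b {a a'} → a ≈ a' → a * b ≈ a' * b
  *-congʳ b a≈a' = *-cong a≈a' (≈-refl {b})

  ∑-cong : ∀ {n} {f g : Vector ℕ n} → (∀ i → f i ≈ g i) → ∑[ i < n ] f i ≈ ∑[ i < n ] g i
  ∑-cong {zero}  _   = ≈-refl
  ∑-cong {suc n} f≈g = +-cong (f≈g zero) (∑-cong (f≈g ∘ suc))

  ≈⇒≡ : ∀ {a b} → a < M → b < M → a ≈ b → a ≡ b
  ≈⇒≡ a<M b<M a≈b = trans (sym (m<n⇒m%n≡m a<M)) (trans (≈⇒%≡% a≈b) (m<n⇒m%n≡m b<M))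

  complement-+-≈0 : ∀ x → (M ∸ x % M) + x ≈ 0
  complement-+-≈0 x = begin
    M ∸ x % M + x                    ≡⟨ cong (M ∸ x % M +_) (m≡m%n+[m/n]*n x M) ⟩
    M ∸ x % M + (x % M + x / M * M)  ≡⟨ +-assoc (M ∸ x % M) (x % M) _ ⟨
    M ∸ x % M + x % M + x / M * M    ≡⟨ cong (_+ x / M * M) (m∸n+n≡m (m%n≤n x M)) ⟩
    M + x / M * M                    ≈⟨ %≡%⇒≈ ([m+kn]%n≡m%n M (x / M) M) ⟩
    M                                ≈⟨ M≈0 ⟩
    0 ∎
    where open ≈-Reasoning

  +-cancelˡ : ∀ x {a b} → x + a ≈ x + b → a ≈ b
  +-cancelˡ x {a} {b} x+a≈x+b = begin
    a                   ≈⟨ +-congʳ a (complement-+-≈0 x) ⟨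
    x⁻ + x + a          ≡⟨ +-assoc x⁻ x a ⟩
    x⁻ + (x + a)        ≈⟨ +-congˡ x⁻ x+a≈x+b ⟩
    x⁻ + (x + b)        ≡⟨ +-assoc x⁻ x b ⟨
    x⁻ + x + b          ≈⟨ +-congʳ b (complement-+-≈0 x) ⟩
    b ∎
    where
    open ≈-Reasoning
    x⁻ = M ∸ x % M

  -- ν is minus the inverse of a, so the root of C + x a is x = ν C.
  linear-root : ∀ {a ν} → a * ν + 1 ≈ 0 → ∀ C x → C + x * a ≈ 0 ⇔ x ≈ ν * C
  linear-root {a} {ν} aν+1≈0 C x = mk⇔ ⇒ ⇐
    where
    open ≈-Reasoning
    ⇒ : C + x * a ≈ 0 → x ≈ ν * C
    ⇒ root = begin
      x                        ≡⟨ trans (cong (x +_) (*-zeroʳ ν)) (+-identityʳ x) ⟨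
      x + ν * 0                ≈⟨ +-congˡ x (*-congˡ ν root) ⟨
      x + ν * (C + x * a)      ≡⟨ expand x ν C a ⟩
      ν * C + x * (a * ν + 1)  ≈⟨ +-congˡ (ν * C) (*-congˡ x aν+1≈0) ⟩
      ν * C + x * 0            ≡⟨ trans (cong (ν * C +_) (*-zeroʳ x)) (+-identityʳ (ν * C)) ⟩
      ν * C ∎
      where
      expand : ∀ x ν C a → x + ν * (C + x * a) ≡ ν * C + x * (a * ν + 1)
      expand = solve-∀
    ⇐ : x ≈ ν * C → C + x * a ≈ 0
    ⇐ x≈νC = begin
      C + x * a                ≈⟨ +-congˡ C (*-congʳ a x≈νC) ⟩
      C + ν * C * a            ≡⟨ factor C ν a ⟩
      C * (a * ν + 1)          ≈⟨ *-congˡ C aν+1≈0 ⟩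
      C * 0                    ≡⟨ *-zeroʳ C ⟩
      0 ∎
      where
      factor : ∀ C ν a → C + ν * C * a ≡ C * (a * ν + 1)
      factor = solve-∀

  sumBelow-𝟙-≈ : ∀ y → sumBelow M (λ x → 𝟙 (x ≈? y)) ≡ 1
  sumBelow-𝟙-≈ y = trans
    (sumBelow-single M (λ x → 𝟙 (x ≈? y)) (m%n<n y M) λ x x<M x≢y%M →
      𝟙-cong (x ≈? y) (no λ ()) (λ x≈y → x≢y%M (≈⇒≡ x<M (m%n<n y M) (≈-trans x≈y (≈-sym (%-≈ y))))) λ ())
    (𝟙-cong (y % M ≈? y) (yes tt) _ λ _ → %-≈ y)

negInverse : ∀ {p} .{{_ : NonZero p}} → Prime p → ∀ a → a % p ≢ 0 → ∃ λ ν → a * ν + 1 ≈ 0 [mod p ]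
negInverse {p} p-prime a a≢0 with coprime-Bézout (prime⇒coprime p-prime {{≢-nonZero a≢0}} (m%n<n a p))
... | Bézout.+- x y 1+yr≡xp = y , (begin
  a * y + 1    ≡⟨ trans (+-comm (a * y) 1) (cong suc (*-comm a y)) ⟩
  1 + y * a    ≈⟨ +-congˡ 1 (*-congˡ y (%-≈ a)) ⟨
  1 + y * r    ≡⟨ 1+yr≡xp ⟩
  x * p        ≈⟨ *M≈0 x ⟩
  0 ∎)
  where
  open Congruence p
  open ≈-Reasoning
  r = a % p
negInverse {suc w} p-prime a a≢0 | Bézout.-+ x y 1+xp≡yr = w * y , (begin
  a * (w * y) + 1          ≡⟨ cong (_+ 1) (rotate a w y) ⟩
  w * (y * a) + 1          ≈⟨ +-congʳ 1 (*-congˡ w (*-congˡ y (%-≈ a))) ⟨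
  w * (y * r) + 1          ≡⟨ cong (λ z → w * z + 1) 1+xp≡yr ⟨
  w * (1 + x * suc w) + 1  ≡⟨ factor w x ⟩
  (w * x + 1) * suc w      ≈⟨ *M≈0 (w * x + 1) ⟩
  0 ∎)
  where
  open Congruence (suc w)
  open ≈-Reasoning
  r = a % suc w
  rotate : ∀ a w y → a * (w * y) ≡ w * (y * a)
  rotate = solve-∀
  factor : ∀ w x → w * (1 + x * suc w) + 1 ≡ (w * x + 1) * suc w
  factor = solve-∀

*+<-injective : ∀ {q a b r r'} .{{_ : NonZero q}} → r < q → r' < q → a * q + r ≡ b * q + r' → a ≡ b × r ≡ r'
*+<-injective {q} {a} {b} {r} {r'} r<q r'<q eq =
  *-cancelʳ-≡ a b q (+-cancelʳ-≡ r (a * q) (b * q) (trans eq (cong (b * q +_) (sym r≡r')))) , r≡r'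
  where
  r≡r' : r ≡ r'
  r≡r' = begin
    r                   ≡⟨ m<n⇒m%n≡m r<q ⟨
    r % q               ≡⟨ [m+kn]%n≡m%n r a q ⟨
    (r + a * q) % q     ≡⟨ cong (_% q) (trans (+-comm r (a * q)) (trans eq (+-comm (b * q) r'))) ⟩
    (r' + b * q) % q    ≡⟨ [m+kn]%n≡m%n r' b q ⟩
    r' % q              ≡⟨ m<n⇒m%n≡m r'<q ⟩
    r' ∎
    where open ≡-Reasoning

module _ (p q : ℕ) .{{_ : NonZero p}} .{{_ : NonZero q}} .{{_ : NonZero (p * q)}} where

  %[p*q]≡⇔ : ∀ Y L y → (Y + q * L) % (p * q) ≡ y ⇔ (Y % q ≡ y % q × (Y / q + L) % p ≡ y / q)
  %[p*q]≡⇔ Y L y = mk⇔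
    (λ Y+qL≡y → swap (*+<-injective (m%n<n Y q) (m%n<n y q) (trans (sym digits) (trans Y+qL≡y (y-digits)))))
    (λ { (low , high) → trans digits (trans (cong₂ (λ a b → a * q + b) high low) (sym y-digits)) })
    where
    open ≡-Reasoning
    y-digits : y ≡ y / q * q + y % q
    y-digits = trans (m≡m%n+[m/n]*n y q) (+-comm (y % q) _)
    digits : (Y + q * L) % (p * q) ≡ (Y / q + L) % p * q + Y % q
    digits = begin
      (Y + q * L) % (p * q)                    ≡⟨ cong (λ Y → (Y + q * L) % (p * q)) (m≡m%n+[m/n]*n Y q) ⟩
      (Y % q + Y / q * q + q * L) % (p * q)    ≡⟨ cong (_% (p * q)) (rearrange (Y % q) (Y / q) q L) ⟩
      ((Y / q + L) * q + Y % q) % (p * q)      ≡⟨ [m*n+o]%[p*n]≡[m*n]%[p*n]+o (Y / q + L) p (m%n<n Y q) ⟩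
      (Y / q + L) * q % (p * q) + Y % q        ≡⟨ cong (_+ Y % q) (m%n*o≡m*o%[n*o] (Y / q + L) p q) ⟨
      (Y / q + L) % p * q + Y % q ∎
      where
      rearrange : ∀ r a q L → r + a * q + q * L ≡ (a + L) * q + r
      rearrange = solve-∀

%≡⇔∸+≈0 : ∀ {p} .{{_ : NonZero p}} {z} a → z < p → a % p ≡ z ⇔ (p ∸ z) + a ≈ 0 [mod p ]
%≡⇔∸+≈0 {p} {z} a z<p = mk⇔
  (λ a%p≡z → begin
    (p ∸ z) + a          ≈⟨ +-congˡ (p ∸ z) (%-≈ a) ⟨
    (p ∸ z) + a % p      ≡⟨ cong ((p ∸ z) +_) a%p≡z ⟩
    (p ∸ z) + z          ≈⟨ complement≈0 ⟩
    0 ∎)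
  (λ root → trans (≈⇒%≡% (+-cancelˡ (p ∸ z) (≈-trans root (≈-sym complement≈0)))) (m<n⇒m%n≡m z<p))
  where
  open Congruence p
  open ≈-Reasoning
  complement≈0 : (p ∸ z) + z ≈ 0
  complement≈0 = ≈-trans (≈-reflexive (m∸n+n≡m (<⇒≤ z<p))) M≈0

^-monoʳ-∣ : ∀ b {m n} → m ≤ n → b ^ m ∣ b ^ n
^-monoʳ-∣ b {m} {n} m≤n = divides (b ^ (n ∸ m)) (trans (cong (b ^_) (sym (m∸n+n≡m m≤n))) (^-distribˡ-+-* b (n ∸ m) m))

-- Counting solutions of affine systems mod p

Matrix : ℕ → ℕ → Set
Matrix n m = Fin n → Fin m → ℕ

module AffineSystems (p : ℕ) .{{_ : NonZero p}} (p-prime : Prime p) where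
  open Congruence p

  affine : ∀ {n m} → Matrix n m → Vector ℕ m → Vector ℕ n → Vector ℕ m
  affine {n} d c t j = c j + ∑[ i < n ] (t i * d i j)

  solves? : ∀ {n m} (d : Matrix n m) c t → Dec (∀ j → affine d c t j ≈ 0)
  solves? d c t = all? λ j → affine d c t j ≈? 0

  #solutions : ∀ {n m} → Matrix n m → Vector ℕ m → ℕ
  #solutions {n} d c = sumBox p n (𝟙 ∘ solves? d c)

  columnCombination : ∀ {n m} → Matrix n m → Vector (Fin p) m → Vector ℕ n
  columnCombination {m = m} d e i = ∑[ j < m ] (d i j * toℕ (e j))

  IndependentColumns : ∀ {n m} → Matrix n m → Set
  IndependentColumns d = ∀ e → (∀ i → columnCombination d e i ≈ 0) → ∀ j → toℕ (e j) ≡ 0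

  independent-cong : ∀ {n m} {d d' : Matrix n m} → (∀ i j → d i j ≡ d' i j) → IndependentColumns d → IndependentColumns d'
  independent-cong d≡d' independent e combination'≈0 =
    independent e λ i → ≈-trans (≈-reflexive (sum-cong-≗ λ j → cong (_* toℕ (e j)) (d≡d' i j))) (combination'≈0 i)

  solves?-respects≗ : ∀ {n m} (d : Matrix n m) c → Respects≗ (𝟙 ∘ solves? d c)
  solves?-respects≗ d c u v u≗v =
    𝟙-cong (solves? d c u) (solves? d c v) (λ S j → ≈-trans (≈-reflexive (sym (affine-≗ j))) (S j))
                                           (λ S j → ≈-trans (≈-reflexive (affine-≗ j)) (S j))
    where
    affine-≗ : ∀ j → affine d c u j ≡ affine d c v j
    affine-≗ j = cong (c j +_) (sum-cong-≗ λ i → cong (_* d i j) (u≗v i))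

  1<p : 1 < p
  1<p = nonTrivial⇒n>1 p {{prime⇒nonTrivial p-prime}}

  pivot-exists : ∀ {n m} (d : Matrix n (suc m)) → IndependentColumns d → ∃ λ i → ¬ d i zero ≈ 0
  pivot-exists {m = m} d independent with any? (λ i → ¬? (d i zero ≈? 0))
  ... | yes pivot = pivot
  ... | no none   = contradiction (independent e₁ combination≈0 zero) (subst (_≢ 0) (sym (toℕ-fromℕ< 1<p)) λ ())
    where
    e₁ : Vector (Fin p) (suc m)
    e₁ zero    = fromℕ< 1<p
    e₁ (suc j) = fromℕ< (<-trans (s≤s z≤n) 1<p)
    combination≈0 : ∀ i → columnCombination d e₁ i ≈ 0
    combination≈0 i = begin
      d i zero * toℕ (e₁ zero) + ∑[ j < m ] (d i (suc j) * toℕ (e₁ (suc j)))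
        ≡⟨ cong₂ _+_ (cong (d i zero *_) (toℕ-fromℕ< 1<p))
                     (trans (sum-cong-≗ λ j → trans (cong (d i (suc j) *_) (toℕ-fromℕ< _)) (*-zeroʳ (d i (suc j)))) (sum-replicate-zero m)) ⟩
      d i zero * 1 + 0    ≡⟨ trans (+-identityʳ _) (*-identityʳ _) ⟩
      d i zero            ≈⟨ decidable-stable (d i zero ≈? 0) (λ d≉0 → none (i , d≉0)) ⟩
      0 ∎
      where open ≈-Reasoning

  -- Gaussian elimination of the variable i₀ with the first equation; ν is minus the inverse of its pivot.
  module Elimination {n m} (d : Matrix (suc n) (suc m)) (i₀ : Fin (suc n)) {ν} (aν+1≈0 : d i₀ zero * ν + 1 ≈ 0) where

    δ : Vector ℕ m
    δ j = d i₀ (suc j)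

    others : Matrix n (suc m)
    others i = d (punchIn i₀ i)

    reduced : Matrix n m
    reduced i j = others i (suc j) + ν * others i zero * δ j

    reducedConst : Vector ℕ (suc m) → Vector ℕ m
    reducedConst c j = c (suc j) + ν * c zero * δ j

    partial : Vector ℕ n → Vector ℕ (suc m)
    partial t j = ∑[ i < n ] (t i * others i j)

    affine-insertAt : ∀ c t x j → affine d c (insertAt t i₀ x) j ≡ c j + (x * d i₀ j + partial t j)
    affine-insertAt c t x j = cong (c j +_) (trans (sum-remove {i = i₀} (λ i → insertAt t i₀ x i * d i j))
      (cong₂ _+_ (cong (_* d i₀ j) (insertAt-lookup t i₀ x))
                 (sum-cong-≗ λ i → cong (_* others i j) (insertAt-punchIn t i₀ x i))))

    affine-reduced : ∀ c t j → affine reduced (reducedConst c) t j ≡ reducedConst c j + (partial t (suc j) + ν * δ j * partial t zero)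
    affine-reduced c t j = cong (reducedConst c j +_) (begin
      ∑[ i < n ] (t i * (others i (suc j) + ν * others i zero * δ j))
        ≡⟨ sum-cong-≗ (λ i → distrib (t i) (others i (suc j)) (others i zero) ν (δ j)) ⟩
      ∑[ i < n ] (t i * others i (suc j) + ν * δ j * (t i * others i zero))
        ≡⟨ ∑-distrib-+ (λ i → t i * others i (suc j)) _ ⟩
      partial t (suc j) + ∑[ i < n ] (ν * δ j * (t i * others i zero))
        ≡⟨ cong (partial t (suc j) +_) (*-distribˡ-sum (ν * δ j) (λ i → t i * others i zero)) ⟨
      partial t (suc j) + ν * δ j * partial t zero ∎)
      where
      open ≡-Reasoning
      distrib : ∀ t A B ν δ → t * (A + ν * B * δ) ≡ t * A + ν * δ * (t * B)
      distrib = solve-∀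

    pivot-root : ∀ c t x → affine d c (insertAt t i₀ x) zero ≈ 0 ⇔ x ≈ ν * (c zero + partial t zero)
    pivot-root c t x = mk⇔ (to ∘ ≈-trans (≈-reflexive (sym rearranged))) (≈-trans (≈-reflexive rearranged) ∘ from)
      where
      open Equivalence (linear-root {d i₀ zero} aν+1≈0 (c zero + partial t zero) x)
      rearranged : affine d c (insertAt t i₀ x) zero ≡ c zero + partial t zero + x * d i₀ zero
      rearranged = trans (affine-insertAt c t x zero) (exchange (c zero) (x * d i₀ zero) (partial t zero))
        where
        exchange : ∀ a b c → a + (b + c) ≡ a + c + b
        exchange = solve-∀

    eliminate : ∀ c t x → x ≈ ν * (c zero + partial t zero) →
      ∀ j → affine d c (insertAt t i₀ x) (suc j) ≈ affine reduced (reducedConst c) t j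
    eliminate c t x x≈root j = begin
      affine d c (insertAt t i₀ x) (suc j)
        ≡⟨ affine-insertAt c t x (suc j) ⟩
      c (suc j) + (x * δ j + partial t (suc j))
        ≈⟨ +-congˡ (c (suc j)) (+-congʳ (partial t (suc j)) (*-congʳ (δ j) x≈root)) ⟩
      c (suc j) + (ν * (c zero + partial t zero) * δ j + partial t (suc j))
        ≡⟨ substitute (c (suc j)) (c zero) (partial t zero) (partial t (suc j)) ν (δ j) ⟩
      reducedConst c j + (partial t (suc j) + ν * δ j * partial t zero)
        ≡⟨ affine-reduced c t j ⟨
      affine reduced (reducedConst c) t j ∎
      where
      open ≈-Reasoning
      substitute : ∀ c₁ c₀ T₀ T₁ ν δ → c₁ + (ν * (c₀ + T₀) * δ + T₁) ≡ c₁ + ν * c₀ * δ + (T₁ + ν * δ * T₀)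
      substitute = solve-∀

    𝟙-solves-insertAt : ∀ c t x → 𝟙 (solves? d c (insertAt t i₀ x))
                                ≡ 𝟙 (x ≈? ν * (c zero + partial t zero)) * 𝟙 (solves? reduced (reducedConst c) t)
    𝟙-solves-insertAt c t x with x ≈? ν * (c zero + partial t zero)
    ... | yes x≈root = trans
      (𝟙-cong (solves? d c (insertAt t i₀ x)) (solves? reduced (reducedConst c) t)
        (λ S j → ≈-trans (≈-sym (eliminate c t x x≈root j)) (S (suc j)))
        (λ { S zero → Equivalence.from (pivot-root c t x) x≈root ; S (suc j) → ≈-trans (eliminate c t x x≈root j) (S j) }))
      (sym (+-identityʳ _))
    ... | no x≉root = 𝟙-cong (solves? d c (insertAt t i₀ x)) (no λ ()) (λ S → x≉root (Equivalence.to (pivot-root c t x) (S zero))) λ ()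

    #solutions-reduced : ∀ c → #solutions d c ≡ #solutions reduced (reducedConst c)
    #solutions-reduced c = begin
      sumBox p (suc n) (𝟙 ∘ solves? d c)
        ≡⟨ sumBox-insertAt p n i₀ _ (solves?-respects≗ d c) ⟩
      sumBelow p (λ x → sumBox p n (λ t → 𝟙 (solves? d c (insertAt t i₀ x))))
        ≡⟨ sumBelow-sumBox-comm p p n (λ x t → 𝟙 (solves? d c (insertAt t i₀ x))) ⟩
      sumBox p n (λ t → sumBelow p (λ x → 𝟙 (solves? d c (insertAt t i₀ x))))
        ≡⟨ sumBox-cong p n (λ t _ → trans (sumBelow-cong p λ x _ → 𝟙-solves-insertAt c t x)
                                          (sumBelow-*ʳ p (λ x → 𝟙 (x ≈? ν * (c zero + partial t zero))) _)) ⟩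
      sumBox p n (λ t → sumBelow p (λ x → 𝟙 (x ≈? ν * (c zero + partial t zero))) * 𝟙 (solves? reduced (reducedConst c) t))
        ≡⟨ sumBox-cong p n (λ t _ → trans (cong (_* 𝟙 (solves? reduced (reducedConst c) t)) (sumBelow-𝟙-≈ _)) (*-identityˡ _)) ⟩
      sumBox p n (𝟙 ∘ solves? reduced (reducedConst c)) ∎
      where open ≡-Reasoning

    -- A dependency e of the reduced columns becomes one of d by giving the first column the coefficient ν Σₖ δₖ eₖ.
    extend : Vector (Fin p) m → Vector (Fin p) (suc m)
    extend e zero    = fromℕ< (m%n<n (ν * ∑[ k < m ] (δ k * toℕ (e k))) p)
    extend e (suc k) = e k

    columnCombination-extend : ∀ e i → columnCombination d (extend e) i
                                       ≈ d i zero * (ν * ∑[ k < m ] (δ k * toℕ (e k))) + ∑[ k < m ] (d i (suc k) * toℕ (e k))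
    columnCombination-extend e i =
      +-congʳ _ (*-congˡ (d i zero) (≈-trans (≈-reflexive (toℕ-fromℕ< _)) (%-≈ (ν * ∑[ k < m ] (δ k * toℕ (e k))))))

    columnCombination-extend-pivot : ∀ e → columnCombination d (extend e) i₀ ≈ 0
    columnCombination-extend-pivot e = begin
      columnCombination d (extend e) i₀    ≈⟨ columnCombination-extend e i₀ ⟩
      d i₀ zero * (ν * τ) + τ              ≡⟨ factor (d i₀ zero) ν τ ⟩
      (d i₀ zero * ν + 1) * τ              ≈⟨ *-congʳ τ aν+1≈0 ⟩
      0 ∎
      where
      open ≈-Reasoning
      τ = ∑[ k < m ] (δ k * toℕ (e k))
      factor : ∀ a ν τ → a * (ν * τ) + τ ≡ (a * ν + 1) * τ
      factor = solve-∀

    columnCombination-extend-others : ∀ e i → columnCombination d (extend e) (punchIn i₀ i) ≈ columnCombination reduced e i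
    columnCombination-extend-others e i = begin
      columnCombination d (extend e) (punchIn i₀ i)   ≈⟨ columnCombination-extend e (punchIn i₀ i) ⟩
      others i zero * (ν * τ) + S                     ≡⟨ reorder (others i zero) ν τ S ⟩
      S + ν * others i zero * τ                       ≡⟨ cong (S +_) (*-distribˡ-sum (ν * others i zero) (λ k → δ k * toℕ (e k))) ⟩
      S + ∑[ k < m ] (ν * others i zero * (δ k * toℕ (e k)))
        ≡⟨ ∑-distrib-+ (λ k → others i (suc k) * toℕ (e k)) _ ⟨
      ∑[ k < m ] (others i (suc k) * toℕ (e k) + ν * others i zero * (δ k * toℕ (e k)))
        ≡⟨ sum-cong-≗ (λ k → distrib (others i (suc k)) (ν * others i zero) (δ k) (toℕ (e k))) ⟨
      columnCombination reduced e i ∎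
      where
      open ≈-Reasoning
      τ = ∑[ k < m ] (δ k * toℕ (e k))
      S = ∑[ k < m ] (others i (suc k) * toℕ (e k))
      reorder : ∀ B ν τ S → B * (ν * τ) + S ≡ S + ν * B * τ
      reorder = solve-∀
      distrib : ∀ A B δ e → (A + B * δ) * e ≡ A * e + B * (δ * e)
      distrib = solve-∀

    independent-reduced : IndependentColumns d → IndependentColumns reduced
    independent-reduced independent e reduced≈0 j = independent (extend e) combination≈0 (suc j)
      where
      combination≈0 : ∀ i → columnCombination d (extend e) i ≈ 0
      combination≈0 i with i Fin.≟ i₀
      ... | yes refl = columnCombination-extend-pivot e
      ... | no i≢i₀  = subst (λ k → columnCombination d (extend e) k ≈ 0) (punchIn-punchOut (i≢i₀ ∘ sym))
                             (≈-trans (columnCombination-extend-others e _) (reduced≈0 _))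

  #solutions-independent : ∀ m n (d : Matrix n m) → IndependentColumns d → ∀ c → #solutions d c * p ^ m ≡ p ^ n
  #solutions-independent zero n d _ c = begin
    #solutions d c * 1                ≡⟨ *-identityʳ _ ⟩
    sumBox p n (𝟙 ∘ solves? d c)     ≡⟨ sumBox-cong p n (λ t _ → 𝟙-cong (solves? d c t) (yes tt) _ λ _ ()) ⟩
    sumBox p n (λ _ → 1)             ≡⟨ sumBox-const p n 1 ⟩
    p ^ n * 1                        ≡⟨ *-identityʳ _ ⟩
    p ^ n ∎
    where open ≡-Reasoning
  #solutions-independent (suc m) zero    d independent c with () ← proj₁ (pivot-exists d independent)
  #solutions-independent (suc m) (suc n) d independent c
    with i₀ , pivot≉0 ← pivot-exists d independent
    with ν , aν+1≈0 ← negInverse p-prime (d i₀ zero) (pivot≉0 ∘ %≡0⇒≈0) = begin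
    #solutions d c * (p * p ^ m)                              ≡⟨ cong (_* (p * p ^ m)) (#solutions-reduced c) ⟩
    #solutions reduced (reducedConst c) * (p * p ^ m)         ≡⟨ x*[y*z]≡y*[x*z] (#solutions reduced (reducedConst c)) p (p ^ m) ⟩
    p * (#solutions reduced (reducedConst c) * p ^ m)         ≡⟨ cong (p *_) (#solutions-independent m n reduced (independent-reduced independent) _) ⟩
    p * p ^ n ∎
    where
    open ≡-Reasoning
    open Elimination d i₀ aν+1≈0
    x*[y*z]≡y*[x*z] : ∀ x y z → x * (y * z) ≡ y * (x * z)
    x*[y*z]≡y*[x*z] = solve-∀

-- Residues of p-adic integers

module PAdic (p : ℕ) .{{_ : NonZero p}} where

  module Modp^ (k : ℕ) = Congruence (p ^ k) {{m^n≢0 p k}}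

  infix 4 _≈_[modp^_]
  _≈_[modp^_] : ℕ → ℕ → ℕ → Set
  a ≈ b [modp^ k ] = Modp^._≈_ k a b

  sumℕ≡sum : ∀ m (f : Fin m → ℕ) → sumℕ p m f ≡ ∑[ j < m ] f j
  sumℕ≡sum zero    f = refl
  sumℕ≡sum (suc m) f = cong (f zero +_) (sumℕ≡sum m (f ∘ suc))

  res-sumₚ : ∀ n (f : Fin n → ℤₚ p) k → res (sumₚ n f) k ≈ ∑[ i < n ] res (f i) k [modp^ k ]
  res-sumₚ zero    f k = Modp^.%-≈ k 0
  res-sumₚ (suc n) f k = ≈-trans (%-≈ _) (+-congˡ (res (f zero) k) (res-sumₚ n (f ∘ suc) k))
    where open Modp^ k

  res-·ₘ : ∀ {n m} (h : Vecₚ n) (A : Fin n → Fin m → ℤₚ p) j k →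
    res ((h ·ₘ A) j) k ≈ ∑[ i < n ] (res (h i) k * res (A i j) k) [modp^ k ]
  res-·ₘ {n} h A j k = ≈-trans (res-sumₚ n (λ i → h i *ₚ A i j) k) (∑-cong λ i → %-≈ (res (h i) k * res (A i j) k))
    where open Modp^ k

  res-≈-res₁ : ∀ (x : ℤₚ p) k → res x (suc k) ≈ res x 1 [mod p ]
  res-≈-res₁ x zero    = Congruence.≈-refl p
  res-≈-res₁ x (suc k) = ≈-trans (%≡%⇒≈ (trans (sym (m∣n⇒o%n%m≡o%m p (p ^ suc k) _ {{_}} {{m^n≢0 p (suc k)}} (m∣m*n (p ^ k))))
                                                (cong (_% p) (coh x (suc k)))))
                                 (res-≈-res₁ x k)
    where open Congruence p

  fromℕ-+ : ∀ a b → fromℕ {p} (a + b) ≈ₚ (fromℕ a +ₚ fromℕ b)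
  fromℕ-+ a b k = %-distribˡ-+ a b (p ^ k) {{m^n≢0 p k}}

  +ₚ-congʳ : ∀ {x x' : ℤₚ p} z → x ≈ₚ x' → (x +ₚ z) ≈ₚ (x' +ₚ z)
  +ₚ-congʳ z x≈x' k = cong (λ a → modP p k (a + res z k)) (x≈x' k)

  +ₚ-assoc : ∀ (x y z : ℤₚ p) → ((x +ₚ y) +ₚ z) ≈ₚ (x +ₚ (y +ₚ z))
  +ₚ-assoc x y z k = ≈⇒%≡% (begin
    modP p k (a + b) + c   ≈⟨ +-congʳ c (%-≈ (a + b)) ⟩
    a + b + c              ≡⟨ +-assoc a b c ⟩
    a + (b + c)            ≈⟨ +-congˡ a (%-≈ (b + c)) ⟨
    a + modP p k (b + c) ∎)
    where
    open Modp^ k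
    open ≈-Reasoning
    a = res x k
    b = res y k
    c = res z k

  fromℕ-*p^≡0 : ∀ a {N K} → N ≤ K → fromℕ {p} (a * p ^ K) ≡ 0ₚ [modp^ N ]
  fromℕ-*p^≡0 a {N} N≤K =
    trans (n∣m⇒m%n≡0 _ (p ^ N) {{m^n≢0 p N}} (∣-trans (^-monoʳ-∣ p N≤K) (n∣m*n a))) (sym (Modp^.0%M≡0 N))

  p^s*-≈⇔ : ∀ s {A B} → A ≈ B [mod p ] ⇔ p ^ s * A ≈ p ^ s * B [modp^ suc s ]
  p^s*-≈⇔ s {A} {B} = mk⇔
    (λ A≈B → Modp^.%≡%⇒≈ (suc s) (begin
      modP p (suc s) (p ^ s * A)   ≡⟨ scaled A ⟨
      A % p * p ^ s                ≡⟨ cong (_* p ^ s) (Congruence.≈⇒%≡% p A≈B) ⟩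
      B % p * p ^ s                ≡⟨ scaled B ⟩
      modP p (suc s) (p ^ s * B) ∎))
    (λ p^sA≈p^sB → Congruence.%≡%⇒≈ p (*-cancelʳ-≡ (A % p) (B % p) (p ^ s) {{m^n≢0 p s}} (begin
      A % p * p ^ s                ≡⟨ scaled A ⟩
      modP p (suc s) (p ^ s * A)   ≡⟨ Modp^.≈⇒%≡% (suc s) p^sA≈p^sB ⟩
      modP p (suc s) (p ^ s * B)   ≡⟨ scaled B ⟨
      B % p * p ^ s ∎)))
    where
    open ≡-Reasoning
    scaled : ∀ A → A % p * p ^ s ≡ modP p (suc s) (p ^ s * A)
    scaled A = trans (m%n*o≡m*o%[n*o] A p (p ^ s) {{_}} {{m^n≢0 p (suc s)}}) (cong (modP p (suc s)) (*-comm A (p ^ s)))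

  +ₚ-≡0 : ∀ {x y : ℤₚ p} K → x ≡ 0ₚ [modp^ K ] → y ≡ 0ₚ [modp^ K ] → (x +ₚ y) ≡ 0ₚ [modp^ K ]
  +ₚ-≡0 K x≡0 y≡0 = trans (cong₂ (λ a b → modP p K (a + b)) x≡0 y≡0) (cong₂ (λ a b → modP p K (a + b)) 0%M≡0 0%M≡0)
    where open Modp^ K

  res₁<p : ∀ (x : ℤₚ p) → res x 1 < p
  res₁<p x = subst (res x 1 <_) (*-identityʳ p) (res-< x 1)

-- Consequences of uniform differentiability

module Differentiable {p : ℕ} .{{_ : NonZero p}} {n m : ℕ} (F : Vecₚ {p} n → Vecₚ {p} m) (F-resp : RespectsEq F)
                      (N : ℕ) (D : Vecₚ {p} n → Fin n → Fin m → ℤₚ p) (differentiable : UnifDiffWith 1 F N D) where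
  open PAdic p

  taylor : ∀ {K} → N ≤ K → ∀ u h → h ≡ᵥ (λ _ → 0ₚ) [modp^ K ] → ∀ j →
    res (F (u +ᵥ h) j) (suc K) ≈ res (F u j) (suc K) + ∑[ i < n ] (res (h i) (suc K) * res (D u i j) (suc K)) [modp^ suc K ]
  taylor {K} N≤K u h h≡0 j = begin
    res (F (u +ᵥ h) j) (suc K)                                    ≡⟨ differentiable K N≤K u h h≡0 j ⟩
    modP p (suc K) (res (F u j) (suc K) + res ((h ·ₘ D u) j) (suc K)) ≈⟨ %-≈ _ ⟩
    res (F u j) (suc K) + res ((h ·ₘ D u) j) (suc K)              ≈⟨ +-congˡ (res (F u j) (suc K)) (res-·ₘ h (D u) j (suc K)) ⟩
    res (F u j) (suc K) + ∑[ i < n ] (res (h i) (suc K) * res (D u i j) (suc K)) ∎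
    where
    open Modp^ (suc K)
    open ≈-Reasoning

  digit-expansion : ∀ {s} → N ≤ s → ∀ (x₀ t : Vector ℕ n) j →
    Fmod F (suc s) (λ i → t i * p ^ s + x₀ i) j
      ≈ Fmod F (suc s) x₀ j + p ^ s * ∑[ i < n ] (t i * res (D (fromℕ ∘ x₀) i j) 1) [modp^ suc s ]
  digit-expansion {s} N≤s x₀ t j = begin
    Fmod F (suc s) (λ i → t i * p ^ s + x₀ i) j
      ≡⟨ F-resp _ (u +ᵥ h) (λ i k → trans (cong (modP p k) (+-comm (t i * p ^ s) (x₀ i))) (fromℕ-+ (x₀ i) _ k)) j (suc s) ⟩
    res (F (u +ᵥ h) j) (suc s)
      ≈⟨ taylor N≤s u h (λ i → fromℕ-*p^≡0 (t i) {s} ≤-refl) j ⟩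
    Fmod F (suc s) x₀ j + ∑[ i < n ] (res (h i) (suc s) * ∂ i (suc s))
      ≈⟨ +-congˡ _ (∑-cong λ i → *-congʳ (∂ i (suc s)) (%-≈ (t i * p ^ s))) ⟩
    Fmod F (suc s) x₀ j + ∑[ i < n ] (t i * p ^ s * ∂ i (suc s))
      ≡⟨ cong (Fmod F (suc s) x₀ j +_) (trans (sum-cong-≗ λ i → x*y*z≡y*[x*z] (t i) (p ^ s) (∂ i (suc s)))
                                              (sym (*-distribˡ-sum (p ^ s) λ i → t i * ∂ i (suc s)))) ⟩
    Fmod F (suc s) x₀ j + p ^ s * ∑[ i < n ] (t i * ∂ i (suc s))
      ≈⟨ +-congˡ _ (Equivalence.to (p^s*-≈⇔ s) (Congruence.∑-cong p λ i → Congruence.*-congˡ p (t i) (res-≈-res₁ (D u i j) s))) ⟩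
    Fmod F (suc s) x₀ j + p ^ s * ∑[ i < n ] (t i * ∂ i 1) ∎
    where
    open Modp^ (suc s)
    open ≈-Reasoning
    u : Vecₚ n
    u = fromℕ ∘ x₀
    h : Vecₚ n
    h i = fromℕ (t i * p ^ s)
    ∂ : Fin n → ℕ → ℕ
    ∂ i = res (D u i j)
    x*y*z≡y*[x*z] : ∀ x y z → x * y * z ≡ y * (x * z)
    x*y*z≡y*[x*z] = solve-∀

  p^N-unit : Fin n → Vecₚ n
  p^N-unit i i' = fromℕ (𝟙 (i' Fin.≟ i) * p ^ N)

  p^N-unit≡0 : ∀ i → p^N-unit i ≡ᵥ (λ _ → 0ₚ) [modp^ N ]
  p^N-unit≡0 i i' = fromℕ-*p^≡0 (𝟙 (i' Fin.≟ i)) {N} ≤-refl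

  ∑-p^N-unit : ∀ i j (A : Fin n → Fin m → ℤₚ p) →
    ∑[ i' < n ] (res (p^N-unit i i') (suc N) * res (A i' j) (suc N)) ≈ p ^ N * res (A i j) (suc N) [modp^ suc N ]
  ∑-p^N-unit i j A = ≈-trans (∑-cong λ i' → *-congʳ (res (A i' j) (suc N)) (%-≈ (𝟙 (i' Fin.≟ i) * p ^ N)))
                             (≈-reflexive (trans (sum-cong-≗ λ i' → *-assoc (𝟙 (i' Fin.≟ i)) (p ^ N) _)
                                                 (∑-𝟙-≟ i λ i' → p ^ N * res (A i' j) (suc N))))
    where open Modp^ (suc N)

  -- Expanding F(u' + p^N eᵢ) both at u' and at u shows p^N ∂ᵢF(u) ≡ p^N ∂ᵢF(u') (mod p^(N+1)).
  jacobian-mod-p-locallyConstant : ∀ u u' g → g ≡ᵥ (λ _ → 0ₚ) [modp^ N ] → (∀ i → u' i ≈ₚ (u +ᵥ g) i) →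
    ∀ i j → res (D u i j) 1 ≡ res (D u' i j) 1
  jacobian-mod-p-locallyConstant u u' g g≡0 u'≈u+g i j = Congruence.≈⇒≡ p (res₁<p (D u i j)) (res₁<p (D u' i j)) (begin
    res (D u i j) 1             ≈⟨ res-≈-res₁ (D u i j) N ⟨
    res (D u i j) (suc N)       ≈⟨ Equivalence.from (p^s*-≈⇔ N) (Modp^.+-cancelˡ (suc N) (Fu + G) (≈-trans (≈-sym at-u) at-u')) ⟩
    res (D u' i j) (suc N)      ≈⟨ res-≈-res₁ (D u' i j) N ⟩
    res (D u' i j) 1 ∎)
    where
    open Congruence.≈-Reasoning p
    open Modp^ (suc N) using (_≈_; ≈-trans; ≈-sym; ≈-reflexive; %-≈; +-cong; +-congˡ; *-congʳ; ∑-cong)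
    L = suc N
    e = p^N-unit i
    Fu = res (F u j) L
    G = ∑[ i' < n ] (res (g i') L * res (D u i' j) L)
    at-u' : res (F (u' +ᵥ e) j) L ≈ (Fu + G) + p ^ N * res (D u' i j) L
    at-u' = ≈-trans (taylor ≤-refl u' e (p^N-unit≡0 i) j)
                    (+-cong (≈-trans (≈-reflexive (F-resp u' (u +ᵥ g) u'≈u+g j L)) (taylor ≤-refl u g g≡0 j))
                            (∑-p^N-unit i j (D u')))
    g+e : Vecₚ n
    g+e = g +ᵥ e
    along-g+e : ∑[ i' < n ] (res (g+e i') L * res (D u i' j) L) ≈ G + p ^ N * res (D u i j) L
    along-g+e = ≈-trans (∑-cong λ i' → ≈-trans (*-congʳ (res (D u i' j) L) (%-≈ (res (g i') L + res (e i') L)))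
                                               (≈-reflexive (*-distribʳ-+ (res (D u i' j) L) (res (g i') L) (res (e i') L))))
               (≈-trans (≈-reflexive (∑-distrib-+ (λ i' → res (g i') L * res (D u i' j) L) _))
                        (+-congˡ G (∑-p^N-unit i j (D u))))
    reassociate : ∀ i' → (u' +ᵥ e) i' ≈ₚ (u +ᵥ g+e) i'
    reassociate i' k = trans (+ₚ-congʳ {u' i'} {(u +ᵥ g) i'} (e i') (u'≈u+g i') k) (+ₚ-assoc (u i') (g i') (e i') k)
    at-u : res (F (u' +ᵥ e) j) L ≈ (Fu + G) + p ^ N * res (D u i j) L
    at-u = ≈-trans (≈-reflexive (F-resp (u' +ᵥ e) (u +ᵥ g+e) reassociate j L))
           (≈-trans (taylor ≤-refl u g+e (λ i' → +ₚ-≡0 {g i'} {e i'} N (g≡0 i') (p^N-unit≡0 i i')) j)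
           (≈-trans (+-congˡ Fu along-g+e) (≈-reflexive (sym (+-assoc Fu G _)))))

-- Lifting equiprobability from p^s to p^(s+1)

module Lifting {p : ℕ} .{{_ : NonZero p}} (p-prime : Prime p) {n m : ℕ} (F : Vecₚ {p} n → Vecₚ {p} m) (F-resp : RespectsEq F)
               (N : ℕ) (D : Vecₚ {p} n → Fin n → Fin m → ℤₚ p) (differentiable : UnifDiffWith 1 F N D) where
  open PAdic p
  open Differentiable F F-resp N D differentiable
  open AffineSystems p p-prime

  fibre? : ∀ k (y : Vector ℕ m) (x : Vector ℕ n) → Dec (∀ j → Fmod F k x j ≡ y j)
  fibre? k y x = all? λ j → Fmod F k x j ≟ y j

  fibre?-respects≗ : ∀ k y → Respects≗ (𝟙 ∘ fibre? k y)
  fibre?-respects≗ k y u v u≗v =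
    𝟙-cong (fibre? k y u) (fibre? k y v) (λ H j → trans (sym (Fmod-≗ j)) (H j)) (λ H j → trans (Fmod-≗ j) (H j))
    where
    Fmod-≗ : ∀ j → Fmod F k u j ≡ Fmod F k v j
    Fmod-≗ j = F-resp (fromℕ ∘ u) (fromℕ ∘ v) (λ i k' → cong (λ z → res (fromℕ z) k') (u≗v i)) j k

  preimageCount≡sumBox : ∀ k y → preimageCount F k y ≡ sumBox (p ^ k) n (𝟙 ∘ fibre? k y)
  preimageCount≡sumBox k y =
    trans (length-filter (fibre? k y) (allVecs (p ^ k) n)) (sumList-allVecs (p ^ k) n _ (fibre?-respects≗ k y))

  jacobian₁ : Vector ℕ n → Matrix n m
  jacobian₁ x i j = res (D (fromℕ ∘ x) i j) 1

  rank⇒independent : ∀ x → RankModpIsM p (D (fromℕ ∘ x)) → IndependentColumns (jacobian₁ x)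
  rank⇒independent x rank e combination≈0 = rank e λ i → begin
    modP p 1 (sumℕ p m (λ j → jacobian₁ x i j * toℕ (e j)))   ≡⟨ %-congʳ {{m^n≢0 p 1}} (*-identityʳ p) ⟩
    sumℕ p m (λ j → jacobian₁ x i j * toℕ (e j)) % p          ≡⟨ cong (_% p) (sumℕ≡sum m _) ⟩
    columnCombination (jacobian₁ x) e i % p                    ≡⟨ Congruence.≈0⇒%≡0 p (combination≈0 i) ⟩
    0 ∎
    where open ≡-Reasoning

  -- As N ≤ k, the Jacobian mod p only depends on the point mod p^k.
  independent-everywhere : ∀ {k} → N ≤ k →
    (∀ (x : Fin n → ℕ) → (∀ i → x i < p ^ k) → RankModpIsM p (D (λ i → fromℕ (x i)))) →
    ∀ x → IndependentColumns (jacobian₁ x)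
  independent-everywhere {k} N≤k rank x =
    independent-cong (jacobian-mod-p-locallyConstant (fromℕ ∘ x₁) (fromℕ ∘ x) g g≡0 x≈x₁+g)
                     (rank⇒independent x₁ (rank x₁ λ i → modP-< p k (x i)))
    where
    instance
      p^k≢0 : NonZero (p ^ k)
      p^k≢0 = m^n≢0 p k
    x₁ : Vector ℕ n
    x₁ i = x i % p ^ k
    g : Vecₚ n
    g i = fromℕ (x i / p ^ k * p ^ k)
    g≡0 : g ≡ᵥ (λ _ → 0ₚ) [modp^ N ]
    g≡0 i = fromℕ-*p^≡0 (x i / p ^ k) N≤k
    x≈x₁+g : ∀ i → fromℕ (x i) ≈ₚ ((fromℕ ∘ x₁) +ᵥ g) i
    x≈x₁+g i k' = trans (cong (modP p k') (m≡m%n+[m/n]*n (x i) (p ^ k))) (fromℕ-+ (x₁ i) _ k')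

  module _ {s} (N≤s : N ≤ s) (independent : ∀ x → IndependentColumns (jacobian₁ x))
           (y : Vector ℕ m) (y< : ∀ j → y j < p ^ suc s) where
    instance
      p^s≢0 : NonZero (p ^ s)
      p^s≢0 = m^n≢0 p s
      p^[1+s]≢0 : NonZero (p * p ^ s)
      p^[1+s]≢0 = m^n≢0 p (suc s)

    y₀ : Vector ℕ m
    y₀ j = modP p s (y j)

    digit<p : ∀ j → y j / p ^ s < p
    digit<p j = m<n*o⇒m/o<n (y< j)

    -- With Y = F(x₀) mod p^(s+1), the condition (Y / p^s + t·∂F(x₀)) mod p = y / p^s is made homogeneous
    -- by moving the digit y / p^s to the constant term as its complement p - y / p^s.
    shiftedConst : Vector ℕ n → Vector ℕ m
    shiftedConst x₀ j = (p ∸ y j / p ^ s) + Fmod F (suc s) x₀ j / p ^ s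

    fibre-lift : ∀ x₀ t j → Fmod F (suc s) (λ i → t i * p ^ s + x₀ i) j ≡ y j
                          ⇔ (Fmod F s x₀ j ≡ y₀ j × affine (jacobian₁ x₀) (shiftedConst x₀) t j ≈ 0 [mod p ])
    fibre-lift x₀ t j = (low ×-⇔ high) ⇔-∘ (%[p*q]≡⇔ p (p ^ s) Y L (y j) ⇔-∘ expansion)
      where
      Y = Fmod F (suc s) x₀ j
      L = ∑[ i < n ] (t i * jacobian₁ x₀ i j)
      Fmod≡ : Fmod F (suc s) (λ i → t i * p ^ s + x₀ i) j ≡ (Y + p ^ s * L) % (p * p ^ s)
      Fmod≡ = trans (sym (m<n⇒m%n≡m (res-< (F _ j) (suc s)))) (Modp^.≈⇒%≡% (suc s) (digit-expansion N≤s x₀ t j))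
      expansion : Fmod F (suc s) (λ i → t i * p ^ s + x₀ i) j ≡ y j ⇔ (Y + p ^ s * L) % (p * p ^ s) ≡ y j
      expansion = mk⇔ (trans (sym Fmod≡)) (trans Fmod≡)
      low : Y % p ^ s ≡ y₀ j ⇔ Fmod F s x₀ j ≡ y₀ j
      low = mk⇔ (trans (sym (coh (F _ j) s))) (trans (coh (F _ j) s))
      high : (Y / p ^ s + L) % p ≡ y j / p ^ s ⇔ affine (jacobian₁ x₀) (shiftedConst x₀) t j ≈ 0 [mod p ]
      high = mk⇔ (Congruence.≈-trans p (Congruence.≈-reflexive p (+-assoc (p ∸ y j / p ^ s) (Y / p ^ s) L)) ∘ to)
                 (from ∘ Congruence.≈-trans p (Congruence.≈-reflexive p (sym (+-assoc (p ∸ y j / p ^ s) (Y / p ^ s) L))))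
        where open Equivalence (%≡⇔∸+≈0 (Y / p ^ s + L) (digit<p j))

    𝟙-fibre-lift : ∀ x₀ t → 𝟙 (fibre? (suc s) y (λ i → t i * p ^ s + x₀ i))
                          ≡ 𝟙 (solves? (jacobian₁ x₀) (shiftedConst x₀) t) * 𝟙 (fibre? s y₀ x₀)
    𝟙-fibre-lift x₀ t = by-low (fibre? s y₀ x₀)
      where
      x : Vector ℕ n
      x i = t i * p ^ s + x₀ i
      solves = solves? (jacobian₁ x₀) (shiftedConst x₀) t
      by-low : (low? : Dec (∀ j → Fmod F s x₀ j ≡ y₀ j)) → 𝟙 (fibre? (suc s) y x) ≡ 𝟙 solves * 𝟙 low?
      by-low (yes low) = trans
        (𝟙-cong (fibre? (suc s) y x) solves (λ H j → proj₂ (Equivalence.to (fibre-lift x₀ t j) (H j)))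
                                           (λ S j → Equivalence.from (fibre-lift x₀ t j) (low j , S j)))
        (sym (*-identityʳ (𝟙 solves)))
      by-low (no ¬low) = trans
        (𝟙-cong (fibre? (suc s) y x) (no λ ()) (λ H → ¬low λ j → proj₁ (Equivalence.to (fibre-lift x₀ t j) (H j))) λ ())
        (sym (*-zeroʳ (𝟙 solves)))

    preimageCount-lift : preimageCount F (suc s) y * p ^ m ≡ preimageCount F s y₀ * p ^ n
    preimageCount-lift = begin
      preimageCount F (suc s) y * p ^ m
        ≡⟨ cong (_* p ^ m) (preimageCount≡sumBox (suc s) y) ⟩
      sumBox (p * p ^ s) n (𝟙 ∘ fibre? (suc s) y) * p ^ m
        ≡⟨ cong (_* p ^ m) (sumBox-* p (p ^ s) n (𝟙 ∘ fibre? (suc s) y) (fibre?-respects≗ (suc s) y)) ⟩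
      sumBox (p ^ s) n (λ x₀ → sumBox p n (λ t → 𝟙 (fibre? (suc s) y (λ i → t i * p ^ s + x₀ i)))) * p ^ m
        ≡⟨ cong (_* p ^ m) (sumBox-cong (p ^ s) n λ x₀ _ → sum-over-digits x₀) ⟩
      sumBox (p ^ s) n (λ x₀ → #solutions (jacobian₁ x₀) (shiftedConst x₀) * 𝟙 (fibre? s y₀ x₀)) * p ^ m
        ≡⟨ sumBox-*ʳ (p ^ s) n (λ x₀ → #solutions (jacobian₁ x₀) (shiftedConst x₀) * 𝟙 (fibre? s y₀ x₀)) (p ^ m) ⟨
      sumBox (p ^ s) n (λ x₀ → #solutions (jacobian₁ x₀) (shiftedConst x₀) * 𝟙 (fibre? s y₀ x₀) * p ^ m)
        ≡⟨ sumBox-cong (p ^ s) n (λ x₀ _ → count-solutions x₀) ⟩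
      sumBox (p ^ s) n (λ x₀ → 𝟙 (fibre? s y₀ x₀) * p ^ n)
        ≡⟨ sumBox-*ʳ (p ^ s) n (𝟙 ∘ fibre? s y₀) (p ^ n) ⟩
      sumBox (p ^ s) n (𝟙 ∘ fibre? s y₀) * p ^ n
        ≡⟨ cong (_* p ^ n) (preimageCount≡sumBox s y₀) ⟨
      preimageCount F s y₀ * p ^ n ∎
      where
      open ≡-Reasoning
      sum-over-digits : ∀ x₀ → sumBox p n (λ t → 𝟙 (fibre? (suc s) y (λ i → t i * p ^ s + x₀ i)))
                              ≡ #solutions (jacobian₁ x₀) (shiftedConst x₀) * 𝟙 (fibre? s y₀ x₀)
      sum-over-digits x₀ = trans (sumBox-cong p n λ t _ → 𝟙-fibre-lift x₀ t)
                                 (sumBox-*ʳ p n (𝟙 ∘ solves? (jacobian₁ x₀) (shiftedConst x₀)) (𝟙 (fibre? s y₀ x₀)))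
      count-solutions : ∀ x₀ → #solutions (jacobian₁ x₀) (shiftedConst x₀) * 𝟙 (fibre? s y₀ x₀) * p ^ m
                             ≡ 𝟙 (fibre? s y₀ x₀) * p ^ n
      count-solutions x₀ = trans (x*y*z≡y*[x*z] (#solutions (jacobian₁ x₀) (shiftedConst x₀)) (𝟙 (fibre? s y₀ x₀)) (p ^ m))
                                 (cong (𝟙 (fibre? s y₀ x₀) *_) (#solutions-independent m n (jacobian₁ x₀) (independent x₀) (shiftedConst x₀)))
        where
        x*y*z≡y*[x*z] : ∀ x y z → x * y * z ≡ y * (x * z)
        x*y*z≡y*[x*z] = solve-∀

  equiprobable-lift : ∀ {s} → N ≤ s → (∀ x → IndependentColumns (jacobian₁ x)) → EquiprobableMod F s → EquiprobableMod F (suc s)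
  equiprobable-lift {s} N≤s independent equiprobable y y' y< y'< = *-cancelʳ-≡ _ _ (p ^ m) {{m^n≢0 p m}} (begin
    preimageCount F (suc s) y * p ^ m                     ≡⟨ preimageCount-lift N≤s independent y y< ⟩
    preimageCount F s (λ j → modP p s (y j)) * p ^ n      ≡⟨ cong (_* p ^ n) (equiprobable _ _ (modP-< p s ∘ y) (modP-< p s ∘ y')) ⟩
    preimageCount F s (λ j → modP p s (y' j)) * p ^ n     ≡⟨ preimageCount-lift N≤s independent y' y'< ⟨
    preimageCount F (suc s) y' * p ^ m ∎)
    where open ≡-Reasoning

theorem3p7 : (p : ℕ) .{{_ : NonZero p}} → Prime p → (n m : ℕ)
    → (F : Vecₚ {p} n → Vecₚ {p} m) → RespectsEq F
    → (N : ℕ) (D : Vecₚ {p} n → Fin n → Fin m → ℤₚ p)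
    → UnifDiffWith 1 F N D → IsLeastN 1 F N
    → (k : ℕ) → N ≤ k → EquiprobableMod F k
    → (∀ (x : Fin n → ℕ) → (∀ i → x i < p ^ k) → RankModpIsM p (D (λ i → fromℕ (x i))))
    → AsymptoticallyEquiprobable F
theorem3p7 p p-prime n m F F-resp N D differentiable _ k N≤k equiprobable rank = k , λ s k≤s → equiprobable-from-k (≤⇒≤′ k≤s)
  where
  open Lifting p-prime F F-resp N D differentiable
  equiprobable-from-k : ∀ {s} → k ≤′ s → EquiprobableMod F s
  equiprobable-from-k (≤′-reflexive refl) = equiprobable
  equiprobable-from-k (≤′-step k≤′s)      =
    equiprobable-lift (≤-trans N≤k (≤′⇒≤ k≤′s)) (independent-everywhere N≤k rank) (equiprobable-from-k k≤′s)
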